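{- Let $Y$ and $Z$ be disjoint finite sets and let $f\colon\mathbf{B}(Y,Z)\to\{0,1\}$ be a monotone-increasing bipartite graph property which is not evasive. If the complex $\Delta_f$ is not empty, then it is collapsible.
   Context: $\mathbf{B}(Y,Z)$ is the set of bipartite graphs on $(Y,Z)$: graphs with vertex set $Y\cup Z$ whose edges all lie in $P=\{\{y,z\}:y\in Y,z\in Z\}$. A bipartite isomorphism is a graph isomorphism that maps $Y$ onto $Y$ and $Z$ onto $Z$; a bipartite graph property is a function $f\colon\mathbf{B}(Y,Z)\to\{0,1\}$ taking equal values on bipartitely isomorphic graphs. $f$ is monotone increasing if adding edges never decreases $f$. A decision tree for $f$ is a rooted binary tree whose internal nodes are labeled by pairs in $P$ (queries) with a "yes" and a "no" child and whose leaves are labeled $0$ or $1$, such that for each graph, following answers from the root reaches a leaf labeled by the value of $f$; $D(f)$ is the least depth of such a tree, and $f$ is evasive if $D(f)=|Y|\cdot|Z|$. $\Delta_f$ is the set of nonempty subsets $E\subseteq P$ such that the graph with edge set $E$ has $f$-value $0$; it is an abstract simplicial complex (a set of finite nonempty sets closed under taking nonempty subsets). A simplex is maximal if contained in no other; a free face is a non-maximal simplex contained in exactly one maximal simplex; an elementary collapse deletes a free face together with all simplices containing it; a complex is collapsible if a finite sequence of elementary collapses reduces it to a complex with exactly one element. -}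

module Defs where

open import Data.Nat using (ℕ; zero; suc; _*_; _≤_; _⊔_)
open import Data.Bool using (Bool; true; false)
open import Data.Fin using (Fin)
open import Data.Fin.Permutation using (Permutation′; _⟨$⟩ʳ_)
open import Data.Vec using (Vec; lookup)
open import Data.Product using (Σ; _×_; ∃; ∃-syntax; _,_)
open import Relation.Nullary using (¬_)
open import Relation.Binary.PropositionalEquality using (_≡_; _≢_)

-- Y = Fin m, Z = Fin n (disjoint finite sets of sizes m, n).
-- An edge set E ⊆ P = Y × Z (equivalently a bipartite graph on (Y,Z))
-- is a Boolean m×n adjacency matrix.
Edges : ℕ → ℕ → Set
Edges m n = Vec (Vec Bool n) m

edge : ∀ {m n} → Edges m n → Fin m → Fin n → Bool
edge E y z = lookup (lookup E y) z

_⊆E_ : ∀ {m n} → Edges m n → Edges m n → Set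
_⊆E_ {m} {n} E F = ∀ (y : Fin m) (z : Fin n) → edge E y z ≡ true → edge F y z ≡ true

NonEmptyE : ∀ {m n} → Edges m n → Set
NonEmptyE {m} {n} E = ∃[ y ] ∃[ z ] edge E y z ≡ true

BipIso : ∀ {m n} → Edges m n → Edges m n → Set
BipIso {m} {n} G H =
  Σ (Permutation′ m) λ σ → Σ (Permutation′ n) λ τ →
    ∀ (y : Fin m) (z : Fin n) → edge H (σ ⟨$⟩ʳ y) (τ ⟨$⟩ʳ z) ≡ edge G y z

-- bipartite graph property (0 = false, 1 = true)
IsBipProperty : ∀ {m n} → (Edges m n → Bool) → Set
IsBipProperty {m} {n} f = ∀ (G H : Edges m n) → BipIso G H → f G ≡ f H

MonotoneIncreasing : ∀ {m n} → (Edges m n → Bool) → Set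
MonotoneIncreasing {m} {n} f = ∀ (G H : Edges m n) → G ⊆E H → f G ≡ true → f H ≡ true

data DTree (m n : ℕ) : Set where
  leaf : Bool → DTree m n
  query : Fin m → Fin n → (yes no : DTree m n) → DTree m n

eval : ∀ {m n} → DTree m n → Edges m n → Bool
eval (leaf b) G = b
eval (query y z t₁ t₀) G with edge G y z
... | true = eval t₁ G
... | false = eval t₀ G

depth : ∀ {m n} → DTree m n → ℕ
depth (leaf _) = zero
depth (query _ _ t₁ t₀) = suc (depth t₁ ⊔ depth t₀)

Computes : ∀ {m n} → DTree m n → (Edges m n → Bool) → Set
Computes {m} {n} t f = ∀ (G : Edges m n) → eval t G ≡ f G

IsDecisionComplexity : ∀ {m n} → (Edges m n → Bool) → ℕ → Set
IsDecisionComplexity {m} {n} f d =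
  (Σ (DTree m n) λ t → Computes t f × depth t ≡ d) ×
  (∀ (t : DTree m n) → Computes t f → d ≤ depth t)

Evasive : ∀ {m n} → (Edges m n → Bool) → Set
Evasive {m} {n} f = IsDecisionComplexity f (m * n)

NotEvasive : ∀ {m n} → (Edges m n → Bool) → Set
NotEvasive {m} {n} f = Σ ℕ λ d → IsDecisionComplexity f d × d ≢ m * n

-- complexes: families of simplices, simplices being edge sets E ⊆ P
Complex : ℕ → ℕ → Set₁
Complex m n = Edges m n → Set

Δ : ∀ {m n} → (Edges m n → Bool) → Complex m n
Δ f E = NonEmptyE E × f E ≡ false

IsEmptyComplex : ∀ {m n} → Complex m n → Set
IsEmptyComplex {m} {n} K = ∀ (σ : Edges m n) → ¬ K σ

Maximal : ∀ {m n} → Complex m n → Edges m n → Set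
Maximal {m} {n} K σ = K σ × (∀ (τ : Edges m n) → K τ → σ ⊆E τ → τ ≡ σ)

FreeFace : ∀ {m n} → Complex m n → Edges m n → Set
FreeFace {m} {n} K σ =
  K σ × ¬ Maximal K σ ×
  Σ (Edges m n) λ τ → Maximal K τ × σ ⊆E τ ×
    (∀ (τ′ : Edges m n) → Maximal K τ′ → σ ⊆E τ′ → τ′ ≡ τ)

ElementaryCollapse : ∀ {m n} → Complex m n → Complex m n → Set
ElementaryCollapse {m} {n} K K′ =
  Σ (Edges m n) λ σ → FreeFace K σ ×
    (∀ (τ : Edges m n) → (K′ τ → K τ × ¬ (σ ⊆E τ)) × (K τ × ¬ (σ ⊆E τ) → K′ τ))

HasExactlyOneElement : ∀ {m n} → Complex m n → Set
HasExactlyOneElement {m} {n} K = Σ (Edges m n) λ σ → K σ × (∀ (τ : Edges m n) → K τ → τ ≡ σ)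

data Collapsible {m n : ℕ} : Complex m n → Set₁ where
  done : ∀ {K} → HasExactlyOneElement K → Collapsible K
  step : ∀ {K K′} → ElementaryCollapse K K′ → Collapsible K′ → Collapsible K

module Submission where

-- Proof idea (the Kahn–Saks–Sturtevant argument).  Identify simplices with
-- edge sets E ⊆ P, i.e. with points of the Boolean cube Edges m n, and let
-- K be the zero set of f, so that Δ f is K minus the empty graph.  A free
-- pair of a family is a pair σ ⊂ σ + e of members such that no other member
-- contains σ; K ↘ L says that L arises from K by deleting free pairs.
--
-- Main lemma
-- (collapse-subcube): if a decision tree t decides membership in K on a
-- subcube Q whose K-part is up-closed in K, and depth t < |I|, then
-- K ↘ K ∖ Q.  Induction on t: a query of a fixed position passes to a
-- subtree, a query of a free position splits Q into its two faces, a leaf 1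
-- means K ∩ Q = ∅, and a leaf 0 means Q ⊆ K, and then Q is removed pair by
-- pair (collapse-full-subcube).
--
-- Non-evasiveness gives a tree of depth < m·n (shallow-tree); on the whole
-- cube this yields K ↘ ∅.  Monotonicity and Δ f ≠ ∅ give f(∅) = 0; each
-- deleted pair not containing ∅ is an elementary collapse of Δ f, and the
-- pair containing ∅ leaves exactly one simplex (collapsible).

open import Defs
open import Data.Nat using (ℕ; zero; suc; _+_; _*_; _≤_; _<_; _⊔_; z≤n; s≤s; s<s⁻¹; pred)
open import Data.Nat.Properties using (≤∧≢⇒<; ≤-trans; ⊔-lub; +-comm; n<1+n; <-trans; 1+n≢0; m⊔n<o⇒m<o; m⊔n<o⇒n<o)
open import Data.Bool using (Bool; true; false)
import Data.Bool as Bool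
open import Data.Fin using (Fin)
import Data.Fin as Fin
open import Data.Fin.Properties using (any?)
open import Data.Vec using (Vec; lookup; _∷_; []; replicate; _[_]≔_)
open import Data.Vec.Properties using (lookup∘update; lookup∘update′; lookup-replicate)
open import Data.Vec.Relation.Binary.Pointwise.Extensional using (ext; Pointwise-≡⇒≡)
open import Data.Product using (Σ; _×_; ∃; _,_; proj₁; proj₂)
open import Data.Product.Properties using (≡-dec)
open import Data.Sum using (_⊎_; inj₁; inj₂; [_,_]; [_,_]′)
open import Data.Empty using (⊥-elim)
open import Relation.Nullary using (¬_; Dec; yes; no)
open import Relation.Binary.PropositionalEquality using (_≡_; _≢_; refl; sym; trans; cong; cong₂; subst)

true≢false : true ≢ false
true≢false ()

by-cases : ∀ {ℓ} {X : Set ℓ} (b : Bool) → (b ≡ true → X) → (b ≡ false → X) → X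
by-cases true  t _ = t refl
by-cases false _ f = f refl

module BooleanCube (m n : ℕ) where

  Graph : Set
  Graph = Edges m n

  _≟ₚ_ : (p q : Fin m × Fin n) → Dec (p ≡ q)
  _≟ₚ_ = ≡-dec Fin._≟_ Fin._≟_

  graph-ext : ∀ {G H : Graph} → (∀ y z → edge G y z ≡ edge H y z) → G ≡ H
  graph-ext h = Pointwise-≡⇒≡ (ext λ y → Pointwise-≡⇒≡ (ext (h y)))

  empty : Graph
  empty = replicate m (replicate n false)

  complete : Graph
  complete = replicate m (replicate n true)

  edge-empty : ∀ y z → edge empty y z ≡ false
  edge-empty y z rewrite lookup-replicate y (replicate n false) = lookup-replicate z false

  edge-complete : ∀ y z → edge complete y z ≡ true
  edge-complete y z rewrite lookup-replicate y (replicate n true) = lookup-replicate z true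

  nonempty⇒≢empty : ∀ {G} → NonEmptyE G → G ≢ empty
  nonempty⇒≢empty (y , z , e) refl = true≢false (trans (sym e) (edge-empty y z))

  ⊆-refl : ∀ (G : Graph) → G ⊆E G
  ⊆-refl G y z e = e

  update : Graph → Fin m → Fin n → Bool → Graph
  update G y z b = G [ y ]≔ (lookup G y [ z ]≔ b)

  update-same : ∀ G y z b → edge (update G y z b) y z ≡ b
  update-same G y z b rewrite lookup∘update y G (lookup G y [ z ]≔ b) = lookup∘update z (lookup G y) b

  update-other : ∀ G y z b {y′ z′} → (y , z) ≢ (y′ , z′) → edge (update G y z b) y′ z′ ≡ edge G y′ z′
  update-other G y z b {y′} {z′} ne with y Fin.≟ y′
  ... | yes refl rewrite lookup∘update y G (lookup G y [ z ]≔ b) =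
    lookup∘update′ (λ z′≡z → ne (cong (y ,_) (sym z′≡z))) (lookup G y) b
  ... | no y≢y′ = cong (λ row → lookup row z′) (lookup∘update′ (λ y′≡y → y≢y′ (sym y′≡y)) G _)

  update-update : ∀ G y z b c → update (update G y z b) y z c ≡ update G y z c
  update-update G y z b c = graph-ext pointwise
    where
    pointwise : ∀ y′ z′ → edge (update (update G y z b) y z c) y′ z′ ≡ edge (update G y z c) y′ z′
    pointwise y′ z′ with (y , z) ≟ₚ (y′ , z′)
    ... | yes refl = trans (update-same (update G y z b) y z c) (sym (update-same G y z c))
    ... | no ne = trans (update-other (update G y z b) y z c ne) (trans (update-other G y z b ne) (sym (update-other G y z c ne)))

  ⊆-update-true : ∀ G y z → G ⊆E update G y z true
  ⊆-update-true G y z y′ z′ e with (y , z) ≟ₚ (y′ , z′)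
  ... | yes refl = update-same G y z true
  ... | no ne = trans (update-other G y z true ne) e

  Family : Set₁
  Family = Complex m n

  _≐_ : Family → Family → Set
  K ≐ L = ∀ τ → (K τ → L τ) × (L τ → K τ)

  ≐-trans : ∀ {K L M} → K ≐ L → L ≐ M → K ≐ M
  ≐-trans K≐L L≐M τ = (λ k → proj₁ (L≐M τ) (proj₁ (K≐L τ) k)) , (λ k → proj₂ (K≐L τ) (proj₂ (L≐M τ) k))

  _∖_ : Family → Family → Family
  (K ∖ L) τ = K τ × ¬ L τ

  FreePair : Family → Graph → Fin m → Fin n → Set
  FreePair K σ y z = edge σ y z ≡ false × K σ × K (update σ y z true) ×
    (∀ τ → K τ → σ ⊆E τ → τ ≡ σ ⊎ τ ≡ update σ y z true)

  withoutPair : Family → Graph → Fin m → Fin n → Family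
  withoutPair K σ y z τ = K τ × τ ≢ σ × τ ≢ update σ y z true

  data _↘_ : Family → Family → Set₁ where
    stop : ∀ {K L} → K ≐ L → K ↘ L
    pair : ∀ {K L} σ y z → FreePair K σ y z → withoutPair K σ y z ↘ L → K ↘ L

  ↘-respˡ : ∀ {K K′ L} → K ≐ K′ → K′ ↘ L → K ↘ L
  ↘-respˡ K≐K′ (stop K′≐L) = stop (≐-trans K≐K′ K′≐L)
  ↘-respˡ K≐K′ (pair σ y z (σ∌e , σ∈ , σ+∈ , only) rest) =
    pair σ y z (σ∌e , proj₂ (K≐K′ σ) σ∈ , proj₂ (K≐K′ _) σ+∈ , λ τ τ∈ → only τ (proj₁ (K≐K′ τ) τ∈))
      (↘-respˡ (λ τ → (λ (k , ne) → proj₁ (K≐K′ τ) k , ne) , (λ (k , ne) → proj₂ (K≐K′ τ) k , ne)) rest)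

  ↘-trans : ∀ {K L M} → K ↘ L → L ↘ M → K ↘ M
  ↘-trans (stop K≐L) L↘M = ↘-respˡ K≐L L↘M
  ↘-trans (pair σ y z free rest) L↘M = pair σ y z free (↘-trans rest L↘M)

  -- The subcube [A, I]: edge sets agreeing with A outside the free positions I.
  record Subcube (A I τ : Graph) : Set where
    constructor subcube
    field agrees : ∀ y z → edge I y z ≡ false → edge τ y z ≡ edge A y z
  open Subcube public

  -- Q is up-closed in K: a member of K above a member of K ∩ Q lies in Q.
  -- This is what keeps pairs inside a subcube free in the whole family.
  UpClosedIn : Family → Family → Set
  UpClosedIn K Q = ∀ σ τ → K σ → Q σ → K τ → σ ⊆E τ → Q τ

  Face : Graph → Graph → Fin m → Fin n → Bool → Family
  Face A I y z b = Subcube (update A y z b) (update I y z false)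

  face-intro : ∀ {A I τ} y z b → Subcube A I τ → edge τ y z ≡ b → Face A I y z b τ
  face-intro {A} {I} {τ} y z b τ∈ e = subcube agrees′
    where
    agrees′ : ∀ y′ z′ → edge (update I y z false) y′ z′ ≡ false → edge τ y′ z′ ≡ edge (update A y z b) y′ z′
    agrees′ y′ z′ fixed with (y , z) ≟ₚ (y′ , z′)
    ... | yes refl = trans e (sym (update-same A y z b))
    ... | no ne = trans (agrees τ∈ y′ z′ (trans (sym (update-other I y z false ne)) fixed))
                        (sym (update-other A y z b ne))

  face-elim : ∀ {A I τ} y z b → edge I y z ≡ true → Face A I y z b τ → Subcube A I τ × edge τ y z ≡ b
  face-elim {A} {I} {τ} y z b free τ∈ =
    subcube agrees′ , trans (agrees τ∈ y z (update-same I y z false)) (update-same A y z b)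
    where
    agrees′ : ∀ y′ z′ → edge I y′ z′ ≡ false → edge τ y′ z′ ≡ edge A y′ z′
    agrees′ y′ z′ fixed with (y , z) ≟ₚ (y′ , z′)
    ... | yes refl = ⊥-elim (true≢false (trans (sym free) fixed))
    ... | no ne = trans (agrees τ∈ y′ z′ (trans (update-other I y z false ne) fixed)) (update-other A y z b ne)

  module Split (A I : Graph) (y : Fin m) (z : Fin n) (free : edge I y z ≡ true) where
    upper lower : Family
    upper = Face A I y z true
    lower = Face A I y z false

    lower∌upper : ∀ τ → lower τ → ¬ upper τ
    lower∌upper τ τ∈₀ τ∈₁ = true≢false (trans (sym (proj₂ (face-elim y z true free τ∈₁))) (proj₂ (face-elim y z false free τ∈₀)))

    upper-upClosed : ∀ {K} → UpClosedIn K (Subcube A I) → UpClosedIn K upper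
    upper-upClosed up σ τ σ∈ σ∈₁ τ∈ σ⊆τ =
      let σ∈Q , σe = face-elim y z true free σ∈₁ in
      face-intro y z true (up σ τ σ∈ σ∈Q τ∈ σ⊆τ) (σ⊆τ y z σe)

    lower-upClosed : ∀ {K} → UpClosedIn K (Subcube A I) → UpClosedIn (K ∖ upper) lower
    lower-upClosed up σ τ (σ∈ , _) σ∈₀ (τ∈ , τ∉₁) σ⊆τ =
      let τ∈Q = up σ τ σ∈ (proj₁ (face-elim y z false free σ∈₀)) τ∈ σ⊆τ in
      by-cases (edge τ y z) (λ e → ⊥-elim (τ∉₁ (face-intro y z true τ∈Q e))) (face-intro y z false τ∈Q)

    halves : ∀ {K} → ((K ∖ upper) ∖ lower) ≐ (K ∖ Subcube A I)
    halves τ = (λ ((τ∈ , τ∉₁) , τ∉₀) → τ∈ , λ τ∈Q → by-cases (edge τ y z)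
                  (λ e → τ∉₁ (face-intro y z true τ∈Q e)) (λ e → τ∉₀ (face-intro y z false τ∈Q e)))
             , (λ (τ∈ , τ∉Q) → (τ∈ , λ τ∈₁ → τ∉Q (proj₁ (face-elim y z true free τ∈₁)))
                             , λ τ∈₀ → τ∉Q (proj₁ (face-elim y z false free τ∈₀)))

    split : ∀ {K} → K ↘ (K ∖ upper) → (K ∖ upper) ↘ ((K ∖ upper) ∖ lower) → K ↘ (K ∖ Subcube A I)
    split K↘ K₁↘ = ↘-trans K↘ (↘-trans K₁↘ (stop halves))

  -- The dimension of [A, I] is the number of free positions, i.e. of true
  -- entries of I.  It is defined on matrices with any number of rows so that
  -- its properties can be proved row by row.
  rowDim : ∀ {k} → Vec Bool k → ℕ
  rowDim []           = zero
  rowDim (true ∷ bs)  = suc (rowDim bs)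
  rowDim (false ∷ bs) = rowDim bs

  dim : ∀ {k} → Vec (Vec Bool n) k → ℕ
  dim []       = zero
  dim (r ∷ rs) = rowDim r + dim rs

  rowDim-unfree : ∀ {k} (bs : Vec Bool k) i → lookup bs i ≡ true → suc (rowDim (bs [ i ]≔ false)) ≡ rowDim bs
  rowDim-unfree (true ∷ bs)  Fin.zero    _ = refl
  rowDim-unfree (false ∷ bs) Fin.zero    ()
  rowDim-unfree (true ∷ bs)  (Fin.suc i) e = cong suc (rowDim-unfree bs i e)
  rowDim-unfree (false ∷ bs) (Fin.suc i) e = rowDim-unfree bs i e

  dim-replaceRow : ∀ {k} (G : Vec (Vec Bool n) k) y r → suc (rowDim r) ≡ rowDim (lookup G y) →
                   suc (dim (G [ y ]≔ r)) ≡ dim G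
  dim-replaceRow (r₀ ∷ G) Fin.zero    r e = cong (_+ dim G) e
  dim-replaceRow (r₀ ∷ G) (Fin.suc y) r e =
    trans (cong suc (+-comm (rowDim r₀) (dim (G [ y ]≔ r))))
      (trans (cong (_+ rowDim r₀) (dim-replaceRow G y r e)) (+-comm (dim G) (rowDim r₀)))

  dim-unfree : ∀ (I : Graph) y z → edge I y z ≡ true → suc (dim (update I y z false)) ≡ dim I
  dim-unfree I y z e = dim-replaceRow I y _ (rowDim-unfree (lookup I y) z e)

  rowDim-free : ∀ {k} (bs : Vec Bool k) → 0 < rowDim bs → ∃ λ i → lookup bs i ≡ true
  rowDim-free (true ∷ bs)  _ = Fin.zero , refl
  rowDim-free (false ∷ bs) p = let i , e = rowDim-free bs p in Fin.suc i , e

  dim-free : ∀ {k} (G : Vec (Vec Bool n) k) → 0 < dim G → ∃ λ y → ∃ λ z → lookup (lookup G y) z ≡ true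
  dim-free []      ()
  dim-free (r ∷ G) p with rowDim r in eq
  ... | suc _ = let z , e = rowDim-free r (subst (0 <_) (sym eq) (s≤s z≤n)) in Fin.zero , z , e
  ... | zero  = let y , z , e = dim-free G p in Fin.suc y , z , e

  rowDim-full : ∀ k → rowDim (replicate k true) ≡ k
  rowDim-full zero    = refl
  rowDim-full (suc k) = cong suc (rowDim-full k)

  dim-full : ∀ k → dim {k} (replicate k (replicate n true)) ≡ k * n
  dim-full zero    = refl
  dim-full (suc k) = cong₂ _+_ (rowDim-full n) (dim-full k)

  point : ∀ {A I τ} → dim I ≡ 0 → Subcube A I τ → τ ≡ A
  point {I = I} dim≡0 τ∈ = graph-ext λ y z → agrees τ∈ y z (fixed y z)
    where
    fixed : ∀ y z → edge I y z ≡ false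
    fixed y z = by-cases (edge I y z) (λ e → ⊥-elim (1+n≢0 (trans (dim-unfree I y z e) dim≡0))) (λ e → e)

  update-in : ∀ A I y z b → edge I y z ≡ true → Subcube A I (update A y z b)
  update-in A I y z b free =
    subcube λ y′ z′ fixed → update-other A y z b (λ { refl → true≢false (trans (sym free) fixed) })

  segment : ∀ {A I τ} y z → dim I ≡ 1 → edge I y z ≡ true → Subcube A I τ →
            τ ≡ update A y z false ⊎ τ ≡ update (update A y z false) y z true
  segment {A} {I} {τ} y z dim≡1 free τ∈ = by-cases (edge τ y z)
      (λ e → inj₂ (trans (point face-dim (face-intro y z true τ∈ e)) (sym (update-update A y z false true))))
      (λ e → inj₁ (point face-dim (face-intro y z false τ∈ e)))
    where
    face-dim : dim (update I y z false) ≡ 0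
    face-dim = cong pred (trans (dim-unfree I y z free) dim≡1)

  -- A subcube of positive dimension contained in K and up-closed in K can be
  -- removed from K by deleting free pairs: split it down to segments, and a
  -- segment {σ, σ + (y,z)} is then a free pair of what is left.
  collapse-full-subcube : ∀ k A I {K} → dim I ≡ suc k → UpClosedIn K (Subcube A I) →
                          (∀ τ → Subcube A I τ → K τ) → K ↘ (K ∖ Subcube A I)
  collapse-full-subcube k A I dim≡ up full with dim-free I (subst (0 <_) (sym dim≡) (s≤s z≤n))
  collapse-full-subcube zero A I {K} dim≡1 up full | y , z , free =
    pair σ y z (update-same A y z false , full σ σ∈ , full σ⁺ σ⁺∈ , only)
      (stop λ τ → (λ (τ∈ , τ≢σ , τ≢σ⁺) → τ∈ , λ τ∈Q → [ τ≢σ , τ≢σ⁺ ] (segment y z dim≡1 free τ∈Q))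
                , (λ (τ∈ , τ∉Q) → τ∈ , (λ { refl → τ∉Q σ∈ }) , (λ { refl → τ∉Q σ⁺∈ })))
    where
    σ σ⁺ : Graph
    σ = update A y z false
    σ⁺ = update σ y z true
    σ∈ : Subcube A I σ
    σ∈ = update-in A I y z false free
    σ⁺∈ : Subcube A I σ⁺
    σ⁺∈ = subst (Subcube A I) (sym (update-update A y z false true)) (update-in A I y z true free)
    only : ∀ τ → K τ → σ ⊆E τ → τ ≡ σ ⊎ τ ≡ σ⁺
    only τ τ∈ σ⊆τ = segment y z dim≡1 free (up σ τ (full σ σ∈) σ∈ τ∈ σ⊆τ)
  collapse-full-subcube (suc k) A I dim≡ up full | y , z , free =
    split (collapse-full-subcube k (update A y z true) I′ face-dim (upper-upClosed up)
             (λ τ τ∈ → full τ (proj₁ (face-elim y z true free τ∈))))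
          (collapse-full-subcube k (update A y z false) I′ face-dim (lower-upClosed up)
             (λ τ τ∈ → full τ (proj₁ (face-elim y z false free τ∈)) , lower∌upper τ τ∈))
    where
    open Split A I y z free
    I′ : Graph
    I′ = update I y z false
    face-dim : dim I′ ≡ suc k
    face-dim = cong pred (trans (dim-unfree I y z free) dim≡)

  eval-yes : ∀ {τ y z} (t₁ t₀ : DTree m n) → edge τ y z ≡ true → eval (query y z t₁ t₀) τ ≡ eval t₁ τ
  eval-yes t₁ t₀ e rewrite e = refl

  eval-no : ∀ {τ y z} (t₁ t₀ : DTree m n) → edge τ y z ≡ false → eval (query y z t₁ t₀) τ ≡ eval t₀ τ
  eval-no t₁ t₀ e rewrite e = refl

  ComputesOn : DTree m n → Family → Family → Set
  ComputesOn t K Q = ∀ τ → Q τ → (K τ → eval t τ ≡ false) × (eval t τ ≡ false → K τ)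

  computes-restrict : ∀ {K Q Q′} (t t′ : DTree m n) → (∀ τ → Q′ τ → Q τ × eval t τ ≡ eval t′ τ) →
                      ComputesOn t K Q → ComputesOn t′ K Q′
  computes-restrict t t′ agree comp τ τ∈′ =
    let τ∈ , same = agree τ τ∈′ in
    (λ k → trans (sym same) (proj₁ (comp τ τ∈) k)) , (λ ev → proj₂ (comp τ τ∈) (trans same ev))

  computes-∖ : ∀ {K L Q} (t : DTree m n) → (∀ τ → Q τ → ¬ L τ) → ComputesOn t K Q → ComputesOn t (K ∖ L) Q
  computes-∖ t disjoint comp τ τ∈ = (λ k → proj₁ (comp τ τ∈) (proj₁ k)) , (λ ev → proj₂ (comp τ τ∈) ev , disjoint τ τ∈)

  collapse-subcube : ∀ (t : DTree m n) A I {K} → UpClosedIn K (Subcube A I) → ComputesOn t K (Subcube A I) →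
                     depth t < dim I → K ↘ (K ∖ Subcube A I)
  collapse-subcube (leaf true) A I up comp _ =
    stop λ τ → (λ τ∈ → τ∈ , λ τ∈Q → true≢false (proj₁ (comp τ τ∈Q) τ∈)) , proj₁
  collapse-subcube (leaf false) A I up comp depth< with dim I in dim≡
  collapse-subcube (leaf false) A I up comp () | zero
  ... | suc k = collapse-full-subcube k A I dim≡ up (λ τ τ∈Q → proj₂ (comp τ τ∈Q) refl)
  collapse-subcube (query y z t₁ t₀) A I {K} up comp depth< =
    by-cases (edge I y z) free-query fixed-query
    where
    free-query : edge I y z ≡ true → K ↘ (K ∖ Subcube A I)
    free-query free = split
        (collapse-subcube t₁ (update A y z true) I′ (upper-upClosed up)
           (computes-restrict (query y z t₁ t₀) t₁ (λ τ τ∈ → let τ∈Q , e = face-elim y z true free τ∈ in τ∈Q , eval-yes t₁ t₀ e) comp)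
           (m⊔n<o⇒m<o _ _ face-bound))
        (collapse-subcube t₀ (update A y z false) I′ (lower-upClosed up)
           (computes-∖ t₀ lower∌upper
             (computes-restrict (query y z t₁ t₀) t₀ (λ τ τ∈ → let τ∈Q , e = face-elim y z false free τ∈ in τ∈Q , eval-no t₁ t₀ e) comp))
           (m⊔n<o⇒n<o _ _ face-bound))
      where
      open Split A I y z free
      I′ : Graph
      I′ = update I y z false
      face-bound : depth t₁ ⊔ depth t₀ < dim I′
      face-bound = s<s⁻¹ (subst (_ <_) (sym (dim-unfree I y z free)) depth<)
    fixed-query : edge I y z ≡ false → K ↘ (K ∖ Subcube A I)
    fixed-query fixed = by-cases (edge A y z)
        (λ e → collapse-subcube t₁ A I up
                 (computes-restrict (query y z t₁ t₀) t₁ (λ τ τ∈ → τ∈ , eval-yes t₁ t₀ (answer τ∈ e)) comp)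
                 (m⊔n<o⇒m<o _ _ subtree-bound))
        (λ e → collapse-subcube t₀ A I up
                 (computes-restrict (query y z t₁ t₀) t₀ (λ τ τ∈ → τ∈ , eval-no t₁ t₀ (answer τ∈ e)) comp)
                 (m⊔n<o⇒n<o _ _ subtree-bound))
      where
      answer : ∀ {τ b} → Subcube A I τ → edge A y z ≡ b → edge τ y z ≡ b
      answer τ∈ e = trans (agrees τ∈ y z fixed) e
      subtree-bound : depth t₁ ⊔ depth t₀ < dim I
      subtree-bound = <-trans (n<1+n _) depth<

  whole-cube : ∀ A τ → Subcube A complete τ
  whole-cube A τ = subcube λ y z fixed → ⊥-elim (true≢false (trans (sym (edge-complete y z)) fixed))

  exhaustive-tree : ∀ (f : Graph → Bool) k A I → dim I ≡ k →
                    Σ (DTree m n) λ t → (∀ τ → Subcube A I τ → eval t τ ≡ f τ) × depth t ≤ k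
  exhaustive-tree f zero A I dim≡0 = leaf (f A) , (λ τ τ∈ → cong f (sym (point dim≡0 τ∈))) , z≤n
  exhaustive-tree f (suc k) A I dim≡ with dim-free I (subst (0 <_) (sym dim≡) (s≤s z≤n))
  ... | y , z , free =
    let face-dim = cong pred (trans (dim-unfree I y z free) dim≡)
        t₁ , correct₁ , depth₁ = exhaustive-tree f k (update A y z true) (update I y z false) face-dim
        t₀ , correct₀ , depth₀ = exhaustive-tree f k (update A y z false) (update I y z false) face-dim
        correct : ∀ τ → Subcube A I τ → eval (query y z t₁ t₀) τ ≡ f τ
        correct τ τ∈ = by-cases (edge τ y z)
          (λ e → trans (eval-yes t₁ t₀ e) (correct₁ τ (face-intro y z true τ∈ e)))
          (λ e → trans (eval-no t₁ t₀ e) (correct₀ τ (face-intro y z false τ∈ e)))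
    in query y z t₁ t₀ , correct , s≤s (⊔-lub depth₁ depth₀)

  -- D(f) ≤ m·n, so a non-evasive property has a decision tree of depth < m·n
  shallow-tree : ∀ {f : Graph → Bool} → NotEvasive f → Σ (DTree m n) λ t → Computes t f × depth t < m * n
  shallow-tree {f} (d , ((t , computes , depth≡d) , optimal) , d≢mn) =
    let t′ , correct′ , depth′ = exhaustive-tree f (m * n) empty complete (dim-full m)
        d≤mn = ≤-trans (optimal t′ (λ τ → correct′ τ (whole-cube empty τ))) depth′
    in t , computes , subst (_< m * n) (sym depth≡d) (≤∧≢⇒< d≤mn d≢mn)

  Zeros : (Graph → Bool) → Family
  Zeros f τ = f τ ≡ false

  NonEmptyPart : Family → Family
  NonEmptyPart K τ = NonEmptyE τ × K τ

  monotone-bottom : ∀ (f : Graph → Bool) → MonotoneIncreasing f → ¬ IsEmptyComplex (Δ f) → f empty ≡ false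
  monotone-bottom f mono Δ≠∅ = by-cases (f empty) (λ f∅ → ⊥-elim (Δ≠∅ (λ τ (_ , fτ) →
      true≢false (trans (sym (mono empty τ (λ y z e → ⊥-elim (true≢false (trans (sym e) (edge-empty y z)))) f∅)) fτ))))
    (λ f∅ → f∅)

  nonEmpty? : (σ : Graph) → Dec (NonEmptyE σ)
  nonEmpty? σ = any? λ y → any? λ z → edge σ y z Bool.≟ true

  pair-collapse : ∀ {K σ y z} → NonEmptyE σ → FreePair K σ y z →
                  ElementaryCollapse (NonEmptyPart K) (NonEmptyPart (withoutPair K σ y z))
  pair-collapse {K} {σ} {y} {z} σ≠∅ (σ∌e , σ∈ , σ⁺∈ , only) =
    σ , ((σ≠∅ , σ∈) , not-maximal , σ⁺ , σ⁺-maximal , ⊆-update-true σ y z , unique) , same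
    where
    σ⁺ : Graph
    σ⁺ = update σ y z true
    σ⁺≠∅ : NonEmptyE σ⁺
    σ⁺≠∅ = y , z , update-same σ y z true
    σ⁺⊈σ : ∀ {τ} → σ⁺ ⊆E τ → τ ≢ σ
    σ⁺⊈σ σ⁺⊆τ refl = true≢false (trans (sym (σ⁺⊆τ y z (update-same σ y z true))) σ∌e)
    not-maximal : ¬ Maximal (NonEmptyPart K) σ
    not-maximal (_ , max) = σ⁺⊈σ (⊆-refl σ⁺) (max σ⁺ (σ⁺≠∅ , σ⁺∈) (⊆-update-true σ y z))
    σ⁺-maximal : Maximal (NonEmptyPart K) σ⁺
    σ⁺-maximal = (σ⁺≠∅ , σ⁺∈) , λ τ (_ , τ∈) σ⁺⊆τ →
      [ (λ τ≡σ → ⊥-elim (σ⁺⊈σ σ⁺⊆τ τ≡σ)) , (λ τ≡σ⁺ → τ≡σ⁺) ]′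
        (only τ τ∈ (λ y′ z′ e → σ⁺⊆τ y′ z′ (⊆-update-true σ y z y′ z′ e)))
    unique : ∀ τ → Maximal (NonEmptyPart K) τ → σ ⊆E τ → τ ≡ σ⁺
    unique τ max σ⊆τ =
      [ (λ τ≡σ → ⊥-elim (not-maximal (subst (Maximal (NonEmptyPart K)) τ≡σ max))) , (λ τ≡σ⁺ → τ≡σ⁺) ]′
        (only τ (proj₂ (proj₁ max)) σ⊆τ)
    same : ∀ τ → (NonEmptyPart (withoutPair K σ y z) τ → NonEmptyPart K τ × ¬ (σ ⊆E τ)) ×
                 (NonEmptyPart K τ × ¬ (σ ⊆E τ) → NonEmptyPart (withoutPair K σ y z) τ)
    same τ = (λ (τ≠∅ , τ∈ , τ≢σ , τ≢σ⁺) → (τ≠∅ , τ∈) , λ σ⊆τ → [ τ≢σ , τ≢σ⁺ ] (only τ τ∈ σ⊆τ))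
           , (λ ((τ≠∅ , τ∈) , σ⊈τ) → τ≠∅ , τ∈ , (λ { refl → σ⊈τ (⊆-refl σ) }) , (λ { refl → σ⊈τ (⊆-update-true σ y z) }))

  -- a free pair {σ, σ + e} with σ = ∅ lies below every member of K, so σ + e is the only simplex
  last-pair : ∀ {K σ y z} → ¬ NonEmptyE σ → FreePair K σ y z → HasExactlyOneElement (NonEmptyPart K)
  last-pair {σ = σ} {y} {z} σ=∅ (_ , _ , σ⁺∈ , only) =
    update σ y z true , ((y , z , update-same σ y z true) , σ⁺∈) , λ τ (τ≠∅ , τ∈) →
      [ (λ { refl → ⊥-elim (σ=∅ τ≠∅) }) , (λ τ≡σ⁺ → τ≡σ⁺) ]′
        (only τ τ∈ (λ y′ z′ e → ⊥-elim (σ=∅ (y′ , z′ , e))))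

  collapsible : ∀ {K L} → K ↘ L → (∀ τ → ¬ L τ) → K empty → Collapsible (NonEmptyPart K)
  collapsible (stop K≐L) L=∅ ∅∈ = ⊥-elim (L=∅ empty (proj₁ (K≐L empty) ∅∈))
  collapsible (pair σ y z free rest) L=∅ ∅∈ with nonEmpty? σ
  ... | no σ=∅ = done (last-pair σ=∅ free)
  ... | yes σ≠∅ = step (pair-collapse σ≠∅ free) (collapsible rest L=∅ (∅∈ , ∅≢σ , ∅≢σ⁺))
    where
    ∅≢σ : empty ≢ σ
    ∅≢σ ∅≡σ = nonempty⇒≢empty σ≠∅ (sym ∅≡σ)
    ∅≢σ⁺ : empty ≢ update σ y z true
    ∅≢σ⁺ ∅≡σ⁺ = nonempty⇒≢empty (y , z , update-same σ y z true) (sym ∅≡σ⁺)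

-- Δ f is the nonempty part of the zero set of f.  The shallow tree computes
-- the zero set on the whole cube, so the whole cube can be removed by free
-- pairs, and f(∅) = 0 turns this into a collapse of Δ f.
proposition5p2 : ∀ (m n : ℕ) (f : Edges m n → Bool) →
    IsBipProperty f → MonotoneIncreasing f → NotEvasive f →
    ¬ IsEmptyComplex (Δ f) → Collapsible (Δ f)
proposition5p2 m n f _ mono notEvasive Δ≠∅ =
  let t , computes , shallow = shallow-tree notEvasive
      everything : ∀ τ → Subcube empty complete τ
      everything = whole-cube empty
      computes-zeros : ComputesOn t (Zeros f) (Subcube empty complete)
      computes-zeros τ _ = (λ fτ → trans (computes τ) fτ) , (λ ev → trans (sym (computes τ)) ev)
      reduction : Zeros f ↘ (Zeros f ∖ Subcube empty complete)
      reduction = collapse-subcube t empty complete (λ _ τ _ _ _ _ → everything τ) computes-zeros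
                    (subst (depth t <_) (sym (dim-full m)) shallow)
  in collapsible reduction (λ τ (_ , τ∉) → τ∉ (everything τ)) (monotone-bottom f mono Δ≠∅)
  where
  open BooleanCube m n
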